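{- Let $\mathsf{CS}$ be an axiomatically appropriate constant specification for $\mathsf{LPLTL}^{\mathsf{int}}$. For every agent $i$, formula $\phi$ and term $t$ there are terms $s_1(t)$ and $s_2(t)$ such that $\vdash_{\mathsf{LPLTL}^{\mathsf{int}}_{\mathsf{CS}}}[t]_i\Box\phi\to[s_1(t)]_i\bigcirc\phi$ and $\vdash_{\mathsf{LPLTL}^{\mathsf{int}}_{\mathsf{CS}}}[t]_i\boxminus\phi\to[s_2(t)]_i\mathsf Y_w\phi$.
   Context: Language. Fix $h\ge 1$ agents $\mathsf{Ag}=\{1,\dots,h\}$ and countable sets of justification constants, variables, and atomic propositions $\mathsf{Prop}$. Terms: $t::=c\mid x\mid\ !t\mid t+t\mid t\cdot t\mid\Uparrow t\mid\Uparrow_P t$. Formulas: $\phi::=P\mid\bot\mid\phi\to\phi\mid\bigcirc\phi\mid\mathsf{Y}_w\phi\mid\phi\,\mathcal{U}\,\phi\mid\phi\,\mathcal{S}\,\phi\mid[t]_i\phi$ ($\bigcirc$ next, $\mathsf{Y}_w$ weak previous, $\mathcal U$ until, $\mathcal S$ since). Abbreviations: $\neg\phi:=\phi\to\bot$, $\top:=\neg\bot$, usual $\lor,\land,\leftrightarrow$; $\mathsf{Y}_s\phi:=\neg\mathsf{Y}_w\neg\phi$; $\Diamond\phi:=\top\,\mathcal U\,\phi$; $\Box\phi:=\neg\Diamond\neg\phi$; $\Diamond^{ - }\phi:=\top\,\mathcal S\,\phi$; $\boxminus\phi:=\neg\Diamond^{ - }\neg\phi$. The system $\mathsf{LPLTL}^{\mathsf{int}}$.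 Axioms: all propositional tautologies; $\bigcirc(\phi\to\psi)\to(\bigcirc\phi\to\bigcirc\psi)$; $\Box(\phi\to\psi)\to(\Box\phi\to\Box\psi)$; $\bigcirc\neg\phi\leftrightarrow\neg\bigcirc\phi$; $\Box(\phi\to\bigcirc\phi)\to(\phi\to\Box\phi)$; $\phi\,\mathcal U\,\psi\to\Diamond\psi$; $\phi\,\mathcal U\,\psi\leftrightarrow\psi\lor(\phi\land\bigcirc(\phi\,\mathcal U\,\psi))$; $\boxminus(\phi\to\psi)\to(\boxminus\phi\to\boxminus\psi)$; $\mathsf Y_w(\phi\to\psi)\to(\mathsf Y_w\phi\to\mathsf Y_w\psi)$; $\mathsf Y_s\phi\to\mathsf Y_w\phi$; $\phi\to\bigcirc\mathsf Y_s\phi$; $\phi\to\mathsf Y_w\bigcirc\phi$; $\Diamond^{ - }\mathsf Y_w\bot$; $\boxminus(\phi\to\mathsf Y_w\phi)\to(\phi\to\boxminus\phi)$; $\phi\,\mathcal S\,\psi\to\Diamond^{ - }\psi$; $\phi\,\mathcal S\,\psi\leftrightarrow\psi\lor(\phi\land\mathsf Y_s(\phi\,\mathcal S\,\psi))$; for all agents $i$, terms $s,t$: $[t]_i(\phi\to\psi)\to([s]_i\phi\to[t\cdot s]_i\psi)$; $[t]_i\phi\to[t+s]_i\phi$ and $[s]_i\phi\to[t+s]_i\phi$; $[t]_i\phi\to\phi$; $[t]_i\phi\to[!t]_i[t]_i\phi$; $\Box[t]_i\phi\to[\Uparrow t]_i\Box\phi$; $\boxminus[t]_i\phi\to[\Uparrow_P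 t]_i\boxminus\phi$; $\Box\phi\to\bigcirc\phi$; $\boxminus\phi\to\mathsf Y_w\phi$. A constant specification $\mathsf{CS}$ is a set of formulas $[c_n]_{i_n}\cdots[c_1]_{i_1}\phi$ ($n\ge1$, constants $c_k$, agents $i_k$, $\phi$ an axiom instance) that is downward closed (removing the outermost $[c_n]_{i_n}$ of a member with $n>1$ gives a member); it is axiomatically appropriate if for every axiom instance $\phi$, every $n\ge1$ and all agents $i_1,\dots,i_n$ there are constants $c_1,\dots,c_n$ with $[c_n]_{i_n}\cdots[c_1]_{i_1}\phi\in\mathsf{CS}$. Rules: modus ponens; from $\vdash\phi$ infer each of $\vdash\bigcirc\phi$, $\vdash\mathsf Y_w\phi$, $\vdash\Box\phi$, $\vdash\boxminus\phi$; and $\vdash\psi$ for every $\psi\in\mathsf{CS}$. -}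

module Defs where

open import Data.Nat using (ℕ; suc)
open import Data.Fin using (Fin)
open import Data.Bool using (Bool; true; false; not; _∨_)
open import Data.Vec using (Vec; []; _∷_)
open import Data.Product using (Σ; _×_)
open import Relation.Binary.PropositionalEquality using (_≡_)

module LPLTL (h : ℕ) where

  Agent : Set
  Agent = Fin h

  data Tm : Set where
    const : ℕ → Tm
    var   : ℕ → Tm
    !_    : Tm → Tm
    _⊕_   : Tm → Tm → Tm
    _·_   : Tm → Tm → Tm
    ⇑_    : Tm → Tm
    ⇑P_   : Tm → Tm

  infixr 5 _⇒_
  infix 4 _⇔_
  infixr 6 _∨'_
  infixr 7 _∧'_
  infix 8 _U_ _S_
  infix 9 ◯_ Yw_ Ys_ ◇_ □_ ◇⁻_ ⊟_ ¬'_
  data Fm : Set where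
    atom : ℕ → Fm
    ⊥'   : Fm
    _⇒_  : Fm → Fm → Fm
    ◯_   : Fm → Fm
    Yw_  : Fm → Fm
    _U_  : Fm → Fm → Fm
    _S_  : Fm → Fm → Fm
    [_]_⟨_⟩ : Tm → Agent → Fm → Fm

  ¬'_ : Fm → Fm
  ¬' φ = φ ⇒ ⊥'

  ⊤' : Fm
  ⊤' = ¬' ⊥'

  _∨'_ : Fm → Fm → Fm
  φ ∨' ψ = (¬' φ) ⇒ ψ

  _∧'_ : Fm → Fm → Fm
  φ ∧' ψ = ¬' (φ ⇒ ¬' ψ)

  _⇔_ : Fm → Fm → Fm
  φ ⇔ ψ = (φ ⇒ ψ) ∧' (ψ ⇒ φ)

  Ys_ : Fm → Fm
  Ys φ = ¬' (Yw (¬' φ))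

  ◇_ : Fm → Fm
  ◇ φ = ⊤' U φ

  □_ : Fm → Fm
  □ φ = ¬' (◇ (¬' φ))

  ◇⁻_ : Fm → Fm
  ◇⁻ φ = ⊤' S φ

  ⊟_ : Fm → Fm
  ⊟ φ = ¬' (◇⁻ (¬' φ))

  -- Propositional tautologies: formulas true under every Boolean valuation,
  -- where every formula whose main connective is not → or ⊥ is treated as a
  -- propositional atom.
  eval : (Fm → Bool) → Fm → Bool
  eval v ⊥'      = false
  eval v (φ ⇒ ψ) = not (eval v φ) ∨ eval v ψ
  eval v φ       = v φ

  Tautology : Fm → Set
  Tautology φ = (v : Fm → Bool) → eval v φ ≡ true

  data Axiom : Fm → Set where
    taut     : ∀ {φ} → Tautology φ → Axiom φ
    ◯K       : ∀ φ ψ → Axiom (◯ (φ ⇒ ψ) ⇒ (◯ φ ⇒ ◯ ψ))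
    □K       : ∀ φ ψ → Axiom (□ (φ ⇒ ψ) ⇒ (□ φ ⇒ □ ψ))
    ◯fun     : ∀ φ → Axiom (◯ (¬' φ) ⇔ ¬' (◯ φ))
    ind      : ∀ φ → Axiom (□ (φ ⇒ ◯ φ) ⇒ (φ ⇒ □ φ))
    U◇       : ∀ φ ψ → Axiom ((φ U ψ) ⇒ ◇ ψ)
    Ufix     : ∀ φ ψ → Axiom ((φ U ψ) ⇔ (ψ ∨' (φ ∧' ◯ (φ U ψ))))
    ⊟K       : ∀ φ ψ → Axiom (⊟ (φ ⇒ ψ) ⇒ (⊟ φ ⇒ ⊟ ψ))
    YwK      : ∀ φ ψ → Axiom (Yw (φ ⇒ ψ) ⇒ (Yw φ ⇒ Yw ψ))
    YsYw     : ∀ φ → Axiom (Ys φ ⇒ Yw φ)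
    ◯Ys      : ∀ φ → Axiom (φ ⇒ ◯ (Ys φ))
    Yw◯      : ∀ φ → Axiom (φ ⇒ Yw (◯ φ))
    start    : Axiom (◇⁻ (Yw ⊥'))
    pind     : ∀ φ → Axiom (⊟ (φ ⇒ Yw φ) ⇒ (φ ⇒ ⊟ φ))
    S◇⁻      : ∀ φ ψ → Axiom ((φ S ψ) ⇒ ◇⁻ ψ)
    Sfix     : ∀ φ ψ → Axiom ((φ S ψ) ⇔ (ψ ∨' (φ ∧' Ys (φ S ψ))))
    jApp     : ∀ i s t φ ψ → Axiom ([ t ] i ⟨ φ ⇒ ψ ⟩ ⇒ ([ s ] i ⟨ φ ⟩ ⇒ [ t · s ] i ⟨ ψ ⟩))
    jSumL    : ∀ i s t φ → Axiom ([ t ] i ⟨ φ ⟩ ⇒ [ t ⊕ s ] i ⟨ φ ⟩)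
    jSumR    : ∀ i s t φ → Axiom ([ s ] i ⟨ φ ⟩ ⇒ [ t ⊕ s ] i ⟨ φ ⟩)
    jRefl    : ∀ i t φ → Axiom ([ t ] i ⟨ φ ⟩ ⇒ φ)
    jPos     : ∀ i t φ → Axiom ([ t ] i ⟨ φ ⟩ ⇒ [ ! t ] i ⟨ [ t ] i ⟨ φ ⟩ ⟩)
    jFut     : ∀ i t φ → Axiom (□ ([ t ] i ⟨ φ ⟩) ⇒ [ ⇑ t ] i ⟨ □ φ ⟩)
    jPast    : ∀ i t φ → Axiom (⊟ ([ t ] i ⟨ φ ⟩) ⇒ [ ⇑P t ] i ⟨ ⊟ φ ⟩)
    □◯       : ∀ φ → Axiom (□ φ ⇒ ◯ φ)
    ⊟Yw      : ∀ φ → Axiom (⊟ φ ⇒ Yw φ)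

  -- [c_n]_{i_n} ... [c_1]_{i_1} φ  (the first entries of the vectors are outermost)
  boxes : ∀ {n} → Vec ℕ n → Vec Agent n → Fm → Fm
  boxes []       []       φ = φ
  boxes (c ∷ cs) (i ∷ is) φ = [ const c ] i ⟨ boxes cs is φ ⟩

  data CSShape : Fm → Set where
    base : ∀ c i {φ} → Axiom φ → CSShape ([ const c ] i ⟨ φ ⟩)
    step : ∀ c i {ψ} → CSShape ψ → CSShape ([ const c ] i ⟨ ψ ⟩)

  record IsConstSpec (CS : Fm → Set) : Set where
    field
      shape    : ∀ ψ → CS ψ → CSShape ψ
      downward : ∀ c i ψ → CS ([ const c ] i ⟨ ψ ⟩) → CSShape ψ → CS ψ

  AxiomaticallyAppropriate : (Fm → Set) → Set
  AxiomaticallyAppropriate CS =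
    ∀ φ → Axiom φ → ∀ n (is : Vec Agent (suc n)) →
      Σ (Vec ℕ (suc n)) (λ cs → CS (boxes cs is φ))

  data _⊢_ (CS : Fm → Set) : Fm → Set where
    ax    : ∀ {φ} → Axiom φ → CS ⊢ φ
    mp    : ∀ {φ ψ} → CS ⊢ (φ ⇒ ψ) → CS ⊢ φ → CS ⊢ ψ
    nec◯  : ∀ {φ} → CS ⊢ φ → CS ⊢ (◯ φ)
    necYw : ∀ {φ} → CS ⊢ φ → CS ⊢ (Yw φ)
    nec□  : ∀ {φ} → CS ⊢ φ → CS ⊢ (□ φ)
    nec⊟  : ∀ {φ} → CS ⊢ φ → CS ⊢ (⊟ φ)
    cs    : ∀ {ψ} → CS ψ → CS ⊢ ψ

-- Both □φ → ◯φ and ⊟φ → Y_w φ are axioms, so an axiomatically appropriate CS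
-- supplies a constant c justifying them; the application axiom then turns a
-- justification t of the premise into the justification c · t of the conclusion.

module Submission where

open import Defs
open import Data.Nat using (ℕ; _≥_)
open import Data.Product using (Σ; _×_; _,_)
open import Data.Vec using ([]; _∷_)

module _ {h : ℕ} (CS : LPLTL.Fm h → Set) where
  open LPLTL h

  axiom-justified : AxiomaticallyAppropriate CS → ∀ {φ} → Axiom φ → (i : Agent) →
                    Σ ℕ (λ c → CS ⊢ [ const c ] i ⟨ φ ⟩)
  axiom-justified aa {φ} axφ i with aa φ axφ 0 (i ∷ [])
  ... | c ∷ [] , c∈CS = c , cs c∈CS

  justified-mp : ∀ {i s t φ ψ} → CS ⊢ [ s ] i ⟨ φ ⇒ ψ ⟩ →
                 CS ⊢ ([ t ] i ⟨ φ ⟩ ⇒ [ s · t ] i ⟨ ψ ⟩)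
  justified-mp {i} {s} {t} {φ} {ψ} ⊢s = mp (ax (jApp i t s φ ψ)) ⊢s

  axiom-lift : AxiomaticallyAppropriate CS → ∀ {φ ψ} → Axiom (φ ⇒ ψ) →
               ∀ i t → Σ Tm (λ s → CS ⊢ ([ t ] i ⟨ φ ⟩ ⇒ [ s ] i ⟨ ψ ⟩))
  axiom-lift aa axφ⇒ψ i t with axiom-justified aa axφ⇒ψ i
  ... | c , ⊢c = const c · t , justified-mp ⊢c

lemma32 : (h : ℕ) → h ≥ 1 → let open LPLTL h in
            (CS : Fm → Set) → IsConstSpec CS → AxiomaticallyAppropriate CS →
            ∀ (i : Agent) (φ : Fm) (t : Tm) →
            Σ Tm (λ s₁ → CS ⊢ ([ t ] i ⟨ □ φ ⟩ ⇒ [ s₁ ] i ⟨ ◯ φ ⟩))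
            × Σ Tm (λ s₂ → CS ⊢ ([ t ] i ⟨ ⊟ φ ⟩ ⇒ [ s₂ ] i ⟨ Yw φ ⟩))
lemma32 h _ CS _ aa i φ t =
  axiom-lift CS aa (□◯ φ) i t , axiom-lift CS aa (⊟Yw φ) i t
  where open LPLTL h
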